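{- Let $\mathcal F$ be a filter on $\omega$ extending the cofinite filter. For every ${\bf\Sigma}^1_1$ set $A\subseteq\omega^\omega$, either there exists $H\in\mathbb H_{\mathcal F}$ with $[H]\cap A=\emptyset$, or there exists $L\in\mathbb L_{\mathcal F}$ with $[L]\subseteq A$.
   Context: A subtree of $\omega^{<\omega}$ is a nonempty subset closed under initial segments; $sn$ denotes the one-term extension of $s$ by $n$; $[T]=\{x\in\omega^\omega:\forall n\ x\upharpoonright n\in T\}$. $\mathcal F^+$ denotes the set of $X\subseteq\omega$ whose complement is not in $\mathcal F$. $\mathbb H_{\mathcal F}$ is the set of subtrees $H\subseteq\omega^{<\omega}$ such that for every $s\in H$, $\{n: sn\in H\}\in\mathcal F$. $\mathbb L_{\mathcal F}$ is the set of subtrees $L\subseteq\omega^{<\omega}$ such that for every $s\in L$, $\{n: sn\in L\}\in\mathcal F^+$. -}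

module Defs where

open import Level using (0ℓ)
open import Data.Nat using (ℕ; _≤_)
open import Data.List using (List; []; _∷_; _∷ʳ_; length)
open import Data.Product using (Σ; ∃; _×_; _,_)
open import Relation.Nullary using (¬_)
open import Data.Empty using (⊥)

Subset : Set₁
Subset = ℕ → Set

Baire : Set
Baire = ℕ → ℕ

infixl 30 _↾_
_↾_ : Baire → ℕ → List ℕ
x ↾ ℕ.zero  = []
x ↾ ℕ.suc n = (x ↾ n) ∷ʳ x n

data _⊑_ {A : Set} : List A → List A → Set where
  []⊑ : ∀ {t} → [] ⊑ t
  ∷⊑  : ∀ {a s t} → s ⊑ t → (a ∷ s) ⊑ (a ∷ t)

record IsTree {A : Set} (T : List A → Set) : Set where
  field
    nonempty : Σ (List A) T
    closed   : ∀ {s t} → s ⊑ t → T t → T s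

Body : (List ℕ → Set) → Baire → Set
Body T x = ∀ n → T (x ↾ n)

zipL : List ℕ → List ℕ → List (ℕ × ℕ)
zipL (a ∷ s) (b ∷ t) = (a , b) ∷ zipL s t
zipL _ _ = []

-- Analytic (boldface Σ^1_1) subsets of ω^ω: projections of bodies of trees on ω × ω.
IsAnalytic : (Baire → Set) → Set₁
IsAnalytic A = Σ (List (ℕ × ℕ) → Set) λ T → IsTree T ×
  (∀ x → (A x → Σ Baire λ y → ∀ n → T (zipL (x ↾ n) (y ↾ n)))
       × ((Σ Baire λ y → ∀ n → T (zipL (x ↾ n) (y ↾ n))) → A x))

Cofinite : Subset → Set
Cofinite X = Σ ℕ λ m → ∀ n → m ≤ n → X n

record IsFilterExtCofinite (F : Subset → Set) : Set₁ where
  field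
    upward    : ∀ {X Y : Subset} → (∀ n → X n → Y n) → F X → F Y
    inter     : ∀ {X Y : Subset} → F X → F Y → F (λ n → X n × Y n)
    proper    : ¬ F (λ _ → ⊥)
    cofinite  : ∀ {X : Subset} → Cofinite X → F X

Positive : (Subset → Set) → Subset → Set
Positive F X = ¬ F (λ n → ¬ X n)

IsH : (Subset → Set) → (List ℕ → Set) → Set
IsH F H = IsTree H × (∀ s → H s → F (λ n → H (s ∷ʳ n)))

IsL : (Subset → Set) → (List ℕ → Set) → Set
IsL F L = IsTree L × (∀ s → L s → Positive F (λ n → L (s ∷ʳ n)))

-- Pair a finite approximation s of x with one, t, of a witness y for x ∈ p[T].  Call (s, t) doomed if it
-- leaves T, or if some F-tree above s exists along whose edges s′ ↦ s′ n every extension of t by a value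
-- m < n is doomed again; excluded middle decides whether ([], []) is doomed.
-- If it is, H follows the F-trees of all doomed positions a witness could pass through.  Only finitely many
-- are active at a node, so H is F-branching, and a witness y for a branch x of H would, as x outgrows each
-- value of y, pass through doomed positions until one leaves T.
-- If it is not, every position that is not doomed has an F⁺-tree above it leading to a node where the
-- witness extends to a position that is not doomed; chaining these trees gives L, along whose branches the
-- witness grows without bound and converges to a y with (x, y) ∈ [T].

module Submission where

open import Defs
open import Level using (0ℓ)
open import Axiom.ExcludedMiddle using (ExcludedMiddle)
open import Axiom.DoubleNegationElimination using (em⇒dne)
open import Data.Nat using (ℕ; zero; suc; _≤_; _<_; _+_; z≤n; s≤s)
open import Data.Nat.Properties using (≤-refl; ≤-trans; ≤-total; ≤-reflexive; <-irrefl; m≤m+n; m≤n+m; n≤1+n; m≤n⇒m<n∨m≡n)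
open import Data.List using (List; []; _∷_; _∷ʳ_; _++_; length; tabulate)
open import Data.List.Membership.Propositional using (_∈_)
open import Data.List.Membership.Propositional.Properties using (∈-++⁺ˡ; ∈-++⁺ʳ; ∈-tabulate⁺)
open import Data.List.Relation.Unary.Any using (here; there)
open import Data.Fin using (Fin; toℕ; fromℕ<)
import Data.Fin as Fin
open import Data.Fin.Properties using (toℕ<n; toℕ-fromℕ<)
open import Data.Bool using () renaming (T to IsTrue)
open import Data.Maybe using (Maybe; just; nothing; is-just; _>>=_)
open import Data.Maybe.Properties using (just-injective)
open import Data.Product using (Σ; ∃; _×_; _,_; proj₁; proj₂)
import Data.Product as Product
open import Data.Sum using (_⊎_; inj₁; inj₂)
import Data.Sum as Sum
open import Data.Empty using (⊥; ⊥-elim)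
open import Data.Unit using (⊤; tt)
open import Function using (_∘_)
open import Relation.Nullary using (¬_; yes; no)
open import Relation.Nullary.Decidable using (True; toWitness; fromWitness)
open import Relation.Binary.PropositionalEquality using (_≡_; refl; sym; trans; cong; subst; subst₂)

⊑-refl : ∀ {A : Set} (s : List A) → s ⊑ s
⊑-refl []      = []⊑
⊑-refl (a ∷ s) = ∷⊑ (⊑-refl s)

⊑-trans : ∀ {A : Set} {s t u : List A} → s ⊑ t → t ⊑ u → s ⊑ u
⊑-trans []⊑     _       = []⊑
⊑-trans (∷⊑ p) (∷⊑ q) = ∷⊑ (⊑-trans p q)

⊑-∷ʳ : ∀ {A : Set} (s : List A) a → s ⊑ (s ∷ʳ a)
⊑-∷ʳ []      a = []⊑
⊑-∷ʳ (b ∷ s) a = ∷⊑ (⊑-∷ʳ s a)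

length-∷ʳ : ∀ {A : Set} (s : List A) a → length (s ∷ʳ a) ≡ suc (length s)
length-∷ʳ []      a = refl
length-∷ʳ (b ∷ s) a = cong suc (length-∷ʳ s a)

length-↾ : ∀ (x : Baire) n → length (x ↾ n) ≡ n
length-↾ x zero    = refl
length-↾ x (suc n) = trans (length-∷ʳ (x ↾ n) (x n)) (cong suc (length-↾ x n))

↾-mono : ∀ (x : Baire) {n k} → n ≤ k → x ↾ n ⊑ x ↾ k
↾-mono x {zero}  _ = []⊑
↾-mono x {suc n} {suc k} (s≤s n≤k) with m≤n⇒m<n∨m≡n n≤k
... | inj₁ n<k  = ⊑-trans (↾-mono x n<k) (⊑-∷ʳ (x ↾ k) (x k))
... | inj₂ refl = ⊑-refl (x ↾ suc n)

zipL-mono : ∀ {s s′ t t′ : List ℕ} → s ⊑ s′ → t ⊑ t′ → zipL s t ⊑ zipL s′ t′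
zipL-mono []⊑    _       = []⊑
zipL-mono (∷⊑ p) []⊑     = []⊑
zipL-mono (∷⊑ p) (∷⊑ q) = ∷⊑ (zipL-mono p q)

zipL-∷ʳ : ∀ (s t : List ℕ) a → length t ≤ length s → zipL (s ∷ʳ a) t ≡ zipL s t
zipL-∷ʳ []      []      a _         = refl
zipL-∷ʳ (b ∷ s) []      a _         = refl
zipL-∷ʳ (b ∷ s) (c ∷ t) a (s≤s t≤s) = cong ((b , c) ∷_) (zipL-∷ʳ s t a t≤s)

-- Entries past the end of the list read as 0; they are never consulted.
nth : List ℕ → ℕ → ℕ
nth []      _       = 0
nth (a ∷ s) zero    = a
nth (a ∷ s) (suc i) = nth s i

nth-⊑ : ∀ {s t} → s ⊑ t → ∀ i → i < length s → nth s i ≡ nth t i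
nth-⊑ (∷⊑ p) zero    _         = refl
nth-⊑ (∷⊑ p) (suc i) (s≤s i<s) = nth-⊑ p i i<s

∷ʳ-nth-⊑ : ∀ {s t} → s ⊑ t → length s < length t → (s ∷ʳ nth t (length s)) ⊑ t
∷ʳ-nth-⊑ {t = b ∷ t} []⊑    _         = ∷⊑ []⊑
∷ʳ-nth-⊑             (∷⊑ p) (s≤s s<t) = ∷⊑ (∷ʳ-nth-⊑ p s<t)

module ChainLimit (c : ℕ → List ℕ) (c-step : ∀ k → c k ⊑ c (suc k))
                  (c-grows : ∀ k → ∃ λ k′ → length (c k) < length (c k′)) where

  c-mono : ∀ {k k′} → k ≤ k′ → c k ⊑ c k′
  c-mono {k} {zero}   z≤n = ⊑-refl (c k)
  c-mono {k} {suc k′} k≤ with m≤n⇒m<n∨m≡n k≤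
  ... | inj₁ (s≤s k≤k′) = ⊑-trans (c-mono k≤k′) (c-step k′)
  ... | inj₂ refl       = ⊑-refl (c k)

  long-enough : ∀ j → ∃ λ k → j < length (c k)
  long-enough zero    with c-grows 0
  ... | k , len<     = k , ≤-trans (s≤s z≤n) len<
  long-enough (suc j) with long-enough j
  ... | k , j<       = proj₁ (c-grows k) , ≤-trans (s≤s j<) (proj₂ (c-grows k))

  limit : Baire
  limit j = nth (c (proj₁ (long-enough j))) j

  limit-nth : ∀ j k → j < length (c k) → limit j ≡ nth (c k) j
  limit-nth j k j< with ≤-total (proj₁ (long-enough j)) k
  ... | inj₁ kⱼ≤k = nth-⊑ (c-mono kⱼ≤k) j (proj₂ (long-enough j))
  ... | inj₂ k≤kⱼ = sym (nth-⊑ (c-mono k≤kⱼ) j j<)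

  limit-↾-⊑ : ∀ n k → n ≤ length (c k) → limit ↾ n ⊑ c k
  limit-↾-⊑ zero    k _  = []⊑
  limit-↾-⊑ (suc n) k n< =
    subst (λ a → (limit ↾ n ∷ʳ a) ⊑ c k)
          (trans (cong (nth (c k)) (length-↾ limit n)) (sym (limit-nth n k n<)))
          (∷ʳ-nth-⊑ (limit-↾-⊑ n k (≤-trans (n≤1+n n) n<))
                    (subst (_< length (c k)) (sym (length-↾ limit n)) n<))

-- Unlike All, this conjunction over a list of large elements stays in Set, so it can define a subset of ω.
All₀ : {A : Set₁} → (A → Set) → List A → Set
All₀ P []       = ⊤
All₀ P (a ∷ as) = P a × All₀ P as

lookup₀ : ∀ {A : Set₁} {P : A → Set} {as a} → All₀ P as → a ∈ as → P a
lookup₀ (p , _)  (here refl) = p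
lookup₀ (_ , ps) (there a∈)  = lookup₀ ps a∈

All₀-++ : ∀ {A : Set₁} {P : A → Set} as {bs} → All₀ P as → All₀ P bs → All₀ P (as ++ bs)
All₀-++ []       _        qs = qs
All₀-++ (a ∷ as) (p , ps) qs = p , All₀-++ as ps qs

All₀-tabulate : ∀ {A : Set₁} {P : A → Set} {n} (f : Fin n → A) → (∀ i → P (f i)) → All₀ P (tabulate f)
All₀-tabulate {n = zero}  f Pf = tt
All₀-tabulate {n = suc n} f Pf = Pf Fin.zero , All₀-tabulate (f ∘ Fin.suc) (Pf ∘ Fin.suc)

module _ {F : Subset → Set} (F-filter : IsFilterExtCofinite F) where
  open IsFilterExtCofinite F-filter

  F-full : ∀ {X : Subset} → (∀ n → X n) → F X
  F-full X-full = cofinite (0 , λ n _ → X-full n)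

  F-All₀ : ∀ {A : Set₁} {Q : A → Set} (P : A → Subset) → (∀ {c} → Q c → F (P c)) →
           ∀ cs → All₀ Q cs → F (λ n → All₀ (λ c → P c n) cs)
  F-All₀ P F-P []       _        = F-full (λ _ → tt)
  F-All₀ P F-P (c ∷ cs) (q , qs) = inter (F-P q) (F-All₀ P F-P cs qs)

  Positive-mono : ∀ {X Y : Subset} → (∀ n → X n → Y n) → Positive F X → Positive F Y
  Positive-mono X⊆Y X⁺ F¬Y = X⁺ (upward (λ n ¬Yn Xn → ¬Yn (X⊆Y n Xn)) F¬Y)

is-just⇒≡just : ∀ {a} {A : Set a} (m : Maybe A) → IsTrue (is-just m) → Σ A λ b → m ≡ just b
is-just⇒≡just (just b) _ = b , refl

module PartialAutomaton {S : Set₁} (step : S → ℕ → Maybe S) (start : S) where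

  run : S → List ℕ → Maybe S
  run st []      = just st
  run st (n ∷ u) = step st n >>= λ st′ → run st′ u

  run-∷ʳ : ∀ st u n → run st (u ∷ʳ n) ≡ (run st u >>= λ a → step a n)
  run-∷ʳ st []      n with step st n
  ... | just b  = refl
  ... | nothing = refl
  run-∷ʳ st (m ∷ u) n with step st m
  ... | just st′ = run-∷ʳ st′ u n
  ... | nothing  = refl

  Accepts : List ℕ → Set
  Accepts u = IsTrue (is-just (run start u))

  private
    runs-closed : ∀ st {s t} → s ⊑ t → IsTrue (is-just (run st t)) → IsTrue (is-just (run st s))
    runs-closed st []⊑            _    = tt
    runs-closed st (∷⊑ {a} s⊑t) runs with step st a
    ... | just st′ = runs-closed st′ s⊑t runs

  Accepts-isTree : IsTree Accepts
  Accepts-isTree = record { nonempty = [] , tt ; closed = runs-closed start }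

  accepts-∷ʳ : ∀ u n {a} → run start u ≡ just a → IsTrue (is-just (step a n)) → Accepts (u ∷ʳ n)
  accepts-∷ʳ u n run≡ steps rewrite run-∷ʳ start u n | run≡ = steps

  step-between : ∀ u n {a b} → run start u ≡ just a → run start (u ∷ʳ n) ≡ just b → step a n ≡ just b
  step-between u n run≡a run≡b rewrite run-∷ʳ start u n | run≡a = run≡b

  module Branch (x : Baire) (x∈ : Body Accepts x) where

    state : ℕ → S
    state k = proj₁ (is-just⇒≡just (run start (x ↾ k)) (x∈ k))

    run-state : ∀ k → run start (x ↾ k) ≡ just (state k)
    run-state k = proj₂ (is-just⇒≡just (run start (x ↾ k)) (x∈ k))

    state-zero : state 0 ≡ start
    state-zero = sym (just-injective (run-state 0))

    step-state : ∀ k → step (state k) (x k) ≡ just (state (suc k))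
    step-state k = step-between (x ↾ k) (x k) (run-state k) (run-state (suc k))

    label-state : (label : S → List ℕ) → label start ≡ [] →
                  (∀ {a n b} → step a n ≡ just b → label b ≡ label a ∷ʳ n) →
                  ∀ k → label (state k) ≡ x ↾ k
    label-state label start≡[] label-step zero    = trans (cong label state-zero) start≡[]
    label-state label start≡[] label-step (suc k) =
      trans (label-step (step-state k)) (cong (_∷ʳ x k) (label-state label start≡[] label-step k))

module Game (lem₀ : ExcludedMiddle 0ℓ) (lem₁ : ExcludedMiddle (Level.suc 0ℓ))
            {F : Subset → Set} (F-filter : IsFilterExtCofinite F)
            (T : List (ℕ × ℕ) → Set) (T-tree : IsTree T) where

  open IsFilterExtCofinite F-filter

  p[T] : Baire → Set
  p[T] x = Σ Baire λ y → ∀ n → T (zipL (x ↾ n) (y ↾ n))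

  data Doomed : List ℕ → List ℕ → Set₁ where
    leaves-T : ∀ {s t} → ¬ T (zipL s t) → Doomed s t
    prune    : ∀ {s t} (K : List ℕ → Set) → K s → (∀ u → K u → F (λ n → K (u ∷ʳ n))) →
               (∀ u n → K u → K (u ∷ʳ n) → ∀ m → m < n → Doomed (u ∷ʳ n) (t ∷ʳ m)) →
               Doomed s t

  Escapes : List ℕ → List ℕ → ℕ → Set₁
  Escapes t u n = ¬ (∀ m → Doomed (u ∷ʳ n) (t ∷ʳ m))

  data ForcesEscape (t : List ℕ) : List ℕ → Set₁ where
    reach : ∀ {u} (X : Subset) → Positive F X →
            (∀ n → X n → Escapes t u n ⊎ ForcesEscape t (u ∷ʳ n)) → ForcesEscape t u

  ¬Doomed⇒∈T : ∀ {s t} → ¬ Doomed s t → T (zipL s t)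
  ¬Doomed⇒∈T ¬doomed = em⇒dne lem₀ (¬doomed ∘ leaves-T)

  escape-witness : ∀ {t u n} → Escapes t u n → ∃ λ m → ¬ Doomed (u ∷ʳ n) (t ∷ʳ m)
  escape-witness escapes =
    em⇒dne lem₁ (λ ¬witness → escapes (λ m → em⇒dne lem₁ (λ ¬doomed → ¬witness (m , ¬doomed))))

  -- If no F⁺-tree above s forces an escape, then s together with the longer nodes u from which none is
  -- forced and at which every one-step extension of t is doomed form an F-tree witnessing that (s, t) is doomed.
  ¬Doomed⇒ForcesEscape : ∀ {s t} → ¬ Doomed s t → ForcesEscape t s
  ¬Doomed⇒ForcesEscape {s} {t} ¬doomed =
    em⇒dne lem₁ λ ¬forces → ¬doomed (prune K (K-root ¬forces) K-F K-edge)
    where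
    K : List ℕ → Set
    K u = True (lem₁ {¬ ForcesEscape t u}) ×
          (u ≡ s ⊎ (length s < length u × True (lem₁ {∀ m → Doomed u (t ∷ʳ m)})))

    K-root : ¬ ForcesEscape t s → K s
    K-root ¬forces = fromWitness ¬forces , inj₁ refl

    K-long : ∀ {u} → K u → length s ≤ length u
    K-long (_ , inj₁ refl)     = ≤-refl
    K-long (_ , inj₂ (s<u , _)) = ≤-trans (n≤1+n (length s)) s<u

    K-F : ∀ u → K u → F (λ n → K (u ∷ʳ n))
    K-F u Ku@(¬forces , _) = upward K-succ F¬Y
      where
      Y : Subset
      Y n = True (lem₁ {Escapes t u n ⊎ ForcesEscape t (u ∷ʳ n)})

      F¬Y : F (λ n → ¬ Y n)
      F¬Y = em⇒dne lem₀ λ Y⁺ → toWitness ¬forces (reach Y Y⁺ (λ n → toWitness))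

      K-succ : ∀ n → ¬ Y n → K (u ∷ʳ n)
      K-succ n ¬Yn =
        fromWitness (¬Yn ∘ fromWitness ∘ inj₂) ,
        inj₂ (subst (length s <_) (sym (length-∷ʳ u n)) (s≤s (K-long Ku)) ,
              fromWitness (em⇒dne lem₁ (¬Yn ∘ fromWitness ∘ inj₁)))

    K-edge : ∀ u n → K u → K (u ∷ʳ n) → ∀ m → m < n → Doomed (u ∷ʳ n) (t ∷ʳ m)
    K-edge u n Ku (_ , inj₁ refl)          m _ =
      ⊥-elim (<-irrefl refl
        (subst (_≤ length u) (length-∷ʳ u n) (K-long Ku)))
    K-edge u n Ku (_ , inj₂ (_ , doomed)) m _ = toWitness doomed m

  -- H keeps x inside the trees of all doomed positions (x ↾ k, t) through which a witness might still pass.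
  data Candidate : Set₁ where
    candidate : ∀ {s t} → Doomed s t → Candidate

  Obligation : Candidate → List ℕ → Set
  Obligation (candidate (leaves-T _))     u = ⊤
  Obligation (candidate (prune K _ _ _)) u = K u

  obligation-root : ∀ {s t} (d : Doomed s t) → Obligation (candidate d) s
  obligation-root (leaves-T _)      = tt
  obligation-root (prune _ K-s _ _) = K-s

  obligation-F : ∀ c {u} → Obligation c u → F (λ n → Obligation c (u ∷ʳ n))
  obligation-F (candidate (leaves-T _))       _  = F-full F-filter (λ _ → tt)
  obligation-F (candidate (prune _ _ K-F _)) Ku = K-F _ Ku

  offspring : ∀ c {u} n → Obligation c u → Obligation c (u ∷ʳ n) → List Candidate
  offspring (candidate (leaves-T _))          n _  _   = []
  offspring (candidate (prune _ _ _ K-edge)) {u} n Ku Kun =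
    tabulate λ (i : Fin n) → candidate (K-edge u n Ku Kun (toℕ i) (toℕ<n i))

  offspring-obligations : ∀ c {u} n (a : Obligation c u) (b : Obligation c (u ∷ʳ n)) →
                          All₀ (λ d → Obligation d (u ∷ʳ n)) (offspring c n a b)
  offspring-obligations (candidate (leaves-T _))          n _  _   = tt
  offspring-obligations (candidate (prune _ _ _ K-edge)) {u} n Ku Kun =
    All₀-tabulate _ (λ i → obligation-root (K-edge u n Ku Kun (toℕ i) (toℕ<n i)))

  module _ {u : List ℕ} (n : ℕ) where

    advance : ∀ cs → All₀ (λ c → Obligation c u) cs → All₀ (λ c → Obligation c (u ∷ʳ n)) cs → List Candidate
    advance []       _        _        = []
    advance (c ∷ cs) (a , as) (b , bs) = c ∷ offspring c n a b ++ advance cs as bs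

    advance-obligations : ∀ cs as bs → All₀ (λ d → Obligation d (u ∷ʳ n)) (advance cs as bs)
    advance-obligations []       _        _        = tt
    advance-obligations (c ∷ cs) (a , as) (b , bs) =
      b , All₀-++ (offspring c n a b) (offspring-obligations c n a b) (advance-obligations cs as bs)

    ∈-advance : ∀ {c cs as bs} → c ∈ cs → c ∈ advance cs as bs
    ∈-advance {as = _ , _} {bs = _ , _} (here refl) = here refl
    ∈-advance {cs = c′ ∷ _} {a , _} {b , _} (there c∈) = there (∈-++⁺ʳ (offspring c′ n a b) (∈-advance c∈))

    ∈-advance-offspring : ∀ {c d cs as bs} (c∈ : c ∈ cs) →
                          d ∈ offspring c n (lookup₀ as c∈) (lookup₀ bs c∈) → d ∈ advance cs as bs
    ∈-advance-offspring {as = _ , _} {bs = _ , _} (here refl) d∈ = there (∈-++⁺ˡ d∈)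
    ∈-advance-offspring {cs = c′ ∷ _} {as = a , _} {b , _} (there c∈) d∈ =
      there (∈-++⁺ʳ (offspring c′ n a b) (∈-advance-offspring c∈ d∈))

  record HState : Set₁ where
    constructor hstate
    field
      node        : List ℕ
      candidates  : List Candidate
      obligations : All₀ (λ c → Obligation c node) candidates
  open HState

  -- Bounding n below by the length of the node forces x k ≥ k along every branch of H, so x eventually
  -- exceeds any given value of a witness.
  Admissible : HState → Subset
  Admissible st n = length (node st) ≤ n × All₀ (λ c → Obligation c (node st ∷ʳ n)) (candidates st)

  F-admissible : ∀ st → F (Admissible st)
  F-admissible st = inter (cofinite (length (node st) , λ _ len≤n → len≤n))
                          (F-All₀ F-filter _ (λ {c} → obligation-F c) (candidates st) (obligations st))

  successor : ∀ st n → Admissible st n → HState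
  successor st n (_ , bs) = hstate (node st ∷ʳ n) (advance n (candidates st) (obligations st) bs)
                                   (advance-obligations n (candidates st) (obligations st) bs)

  stepH : HState → ℕ → Maybe HState
  stepH st n with lem₀ {Admissible st n}
  ... | yes adm = just (successor st n adm)
  ... | no _    = nothing

  stepH-just : ∀ {st n st′} → stepH st n ≡ just st′ → Σ (Admissible st n) λ adm → successor st n adm ≡ st′
  stepH-just {st} {n} steps with lem₀ {Admissible st n}
  stepH-just refl | yes adm = adm , refl

  admissible⇒steps : ∀ {st n} → Admissible st n → IsTrue (is-just (stepH st n))
  admissible⇒steps {st} {n} adm with lem₀ {Admissible st n}
  ... | yes _ = tt
  ... | no ¬adm = ¬adm adm

  module HSide (d₀ : Doomed [] []) where

    start : HState
    start = hstate [] (candidate d₀ ∷ []) (obligation-root d₀ , tt)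

    open PartialAutomaton stepH start public renaming (Accepts to H)

    H-isH : IsH F H
    H-isH = Accepts-isTree , λ s s∈H →
      let (st , run≡) = is-just⇒≡just (run start s) s∈H in
      upward (λ n adm → accepts-∷ʳ s n run≡ (admissible⇒steps adm)) (F-admissible st)

    module _ (x : Baire) (x∈H : Body H x) (y : Baire) (xy∈T : ∀ n → T (zipL (x ↾ n) (y ↾ n))) where
      open Branch x x∈H

      node-state : ∀ k → node (state k) ≡ x ↾ k
      node-state = label-state node refl (λ steps → cong node (sym (proj₂ (stepH-just steps))))

      admissible : ∀ k → Admissible (state k) (x k)
      admissible k = proj₁ (stepH-just (step-state k))

      successor-state : ∀ k → successor (state k) (x k) (admissible k) ≡ state (suc k)
      successor-state k = proj₂ (stepH-just (step-state k))

      persists : ∀ {c} k d → c ∈ candidates (state k) → c ∈ candidates (state (d + k))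
      persists k zero    c∈ = c∈
      persists k (suc d) c∈ =
        subst (λ st → _ ∈ candidates st) (successor-state (d + k)) (∈-advance (x (d + k)) (persists k d c∈))

      refute : ∀ {s t} (d : Doomed s t) k j → s ≡ x ↾ k → t ≡ y ↾ j → j ≤ k →
               candidate d ∈ candidates (state k) → ⊥
      refute (leaves-T ∉T) k j refl refl j≤k _ =
        ∉T (IsTree.closed T-tree (zipL-mono (⊑-refl (x ↾ k)) (↾-mono y j≤k)) (xy∈T k))
      refute (prune K K-s K-F K-edge) k j refl refl j≤k d∈ =
        refute (K-edge u n Ku Kun (toℕ i) (toℕ<n i)) (suc k₁) (suc j)
               (cong (_∷ʳ n) (node-state k₁)) (cong (y ↾ j ∷ʳ_) (toℕ-fromℕ< yj<n))
               (s≤s (≤-trans j≤k (m≤n+m k (suc (y j))))) offspring∈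
        where
        k₁ : ℕ
        k₁ = suc (y j) + k
        d∈₁ : candidate (prune K K-s K-F K-edge) ∈ candidates (state k₁)
        d∈₁ = persists k (suc (y j)) d∈
        u : List ℕ
        u = node (state k₁)
        n : ℕ
        n = x k₁
        Ku : K u
        Ku = lookup₀ (obligations (state k₁)) d∈₁
        Kun : K (u ∷ʳ n)
        Kun = lookup₀ (proj₂ (admissible k₁)) d∈₁
        yj<n : y j < n
        yj<n = ≤-trans (s≤s (m≤m+n (y j) k))
                 (subst (_≤ n) (trans (cong length (node-state k₁)) (length-↾ x k₁)) (proj₁ (admissible k₁)))
        i : Fin n
        i = fromℕ< yj<n
        offspring∈ : candidate (K-edge u n Ku Kun (toℕ i) (toℕ<n i)) ∈ candidates (state (suc k₁))
        offspring∈ = subst (λ st → candidate (K-edge u n Ku Kun (toℕ i) (toℕ<n i)) ∈ candidates st)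
                           (successor-state k₁) (∈-advance-offspring n d∈₁ (∈-tabulate⁺ i))

      start-refuted : ⊥
      start-refuted = refute d₀ 0 0 refl refl z≤n
                   (subst (λ st → candidate d₀ ∈ candidates st) (sym state-zero) (here refl))

    H-disjoint-p[T] : ∀ x → Body H x → ¬ p[T] x
    H-disjoint-p[T] x x∈H (y , xy∈T) = start-refuted x x∈H y xy∈T

  record LState : Set₁ where
    constructor lstate
    field
      node trunk  : List ℕ
      node×trunk∈T : T (zipL node trunk)
      trunk-short : length trunk ≤ length node
      forces      : ForcesEscape trunk node
  open LState

  fresh : ∀ {s t} → length t ≤ length s → ¬ Doomed s t → LState
  fresh short ¬doomed = lstate _ _ (¬Doomed⇒∈T ¬doomed) short (¬Doomed⇒ForcesEscape ¬doomed)

  next-state : ∀ {u t} → T (zipL u t) → length t ≤ length u →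
               ∀ n → Escapes t u n ⊎ ForcesEscape t (u ∷ʳ n) → LState
  next-state {u} {t} _ short n (inj₁ escapes) =
    fresh (subst₂ _≤_ (sym (length-∷ʳ t _)) (sym (length-∷ʳ u n)) (s≤s short))
          (proj₂ (escape-witness escapes))
  next-state {u} {t} ut∈T short n (inj₂ forces) =
    lstate (u ∷ʳ n) t (subst T (sym (zipL-∷ʳ u t n short)) ut∈T)
           (subst (length t ≤_) (sym (length-∷ʳ u n)) (≤-trans short (n≤1+n (length u)))) forces

  stepL : LState → ℕ → Maybe LState
  stepL (lstate u t ut∈T short (reach X _ moves)) n with lem₀ {X n}
  ... | yes n∈X = just (next-state ut∈T short n (moves n n∈X))
  ... | no _    = nothing

  stepL-just : ∀ {u t ut∈T short X X⁺ moves n st′} →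
               stepL (lstate u t ut∈T short (reach X X⁺ moves)) n ≡ just st′ →
               Σ (X n) λ n∈X → next-state ut∈T short n (moves n n∈X) ≡ st′
  stepL-just {X = X} {n = n} steps with lem₀ {X n}
  stepL-just refl | yes n∈X = n∈X , refl

  next-state-node : ∀ {u t ut∈T short} n w → node (next-state {u} {t} ut∈T short n w) ≡ u ∷ʳ n
  next-state-node n (inj₁ _) = refl
  next-state-node n (inj₂ _) = refl

  next-state-trunk : ∀ {u t ut∈T short} n w → t ⊑ trunk (next-state {u} {t} ut∈T short n w)
  next-state-trunk {t = t} n (inj₁ _) = ⊑-∷ʳ t _
  next-state-trunk {t = t} n (inj₂ _) = ⊑-refl t

  stepL-node : ∀ a {n b} → stepL a n ≡ just b → node b ≡ node a ∷ʳ n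
  stepL-node (lstate u t ut∈T short (reach X X⁺ moves)) {n} steps
    with stepL-just {u} {t} {ut∈T} {short} {X} {X⁺} {moves} steps
  ... | n∈X , refl = next-state-node n (moves n n∈X)

  stepL-trunk : ∀ a {n b} → stepL a n ≡ just b → trunk a ⊑ trunk b
  stepL-trunk (lstate u t ut∈T short (reach X X⁺ moves)) {n} steps
    with stepL-just {u} {t} {ut∈T} {short} {X} {X⁺} {moves} steps
  ... | n∈X , refl = next-state-trunk n (moves n n∈X)

  stepL-positive : ∀ st → Positive F (λ n → IsTrue (is-just (stepL st n)))
  stepL-positive st@(lstate _ _ _ _ (reach X X⁺ _)) = Positive-mono F-filter steps X⁺
    where
    steps : ∀ n → X n → IsTrue (is-just (stepL st n))
    steps n n∈X with lem₀ {X n}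
    ... | yes _  = tt
    ... | no n∉X = n∉X n∈X

  module LSide (¬doomed₀ : ¬ Doomed [] []) where

    open PartialAutomaton stepL (fresh z≤n ¬doomed₀) public renaming (Accepts to L)

    L-isL : IsL F L
    L-isL = Accepts-isTree , λ s s∈L →
      let (st , run≡) = is-just⇒≡just (run _ s) s∈L in
      Positive-mono F-filter (λ n → accepts-∷ʳ s n run≡) (stepL-positive st)

    module _ (x : Baire) (x∈L : Body L x) where
      open Branch x x∈L

      node-state : ∀ k → node (state k) ≡ x ↾ k
      node-state = label-state node refl (λ {a} → stepL-node a)

      -- Escapes happen after finitely many steps because ForcesEscape is well founded.
      mutual
        grows-from : ∀ {u t ut∈T short} (r : ForcesEscape t u) k → state k ≡ lstate u t ut∈T short r →
                     ∃ λ k′ → length t < length (trunk (state k′))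
        grows-from (reach X X⁺ moves) k state≡
          with stepL-just {X⁺ = X⁺} {moves}
                 (subst (λ st → stepL st (x k) ≡ just (state (suc k))) state≡ (step-state k))
        ... | n∈X , next≡ = grows-via (moves (x k) n∈X) (suc k) next≡

        grows-via : ∀ {u t ut∈T short n} (w : Escapes t u n ⊎ ForcesEscape t (u ∷ʳ n)) k →
                    next-state ut∈T short n w ≡ state k → ∃ λ k′ → length t < length (trunk (state k′))
        grows-via {t = t} (inj₁ _) k next≡ =
          k , subst (λ st → length t < length (trunk st)) next≡ (≤-reflexive (sym (length-∷ʳ t _)))
        grows-via (inj₂ r) k next≡ = grows-from r k (sym next≡)

      trunk-grows : ∀ k → ∃ λ k′ → length (trunk (state k)) < length (trunk (state k′))
      trunk-grows k = grows-from (forces (state k)) k refl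

      open ChainLimit (trunk ∘ state) (λ k → stepL-trunk (state k) (step-state k)) trunk-grows
        using (long-enough; limit-↾-⊑) renaming (limit to y)

      xy∈T : ∀ n → T (zipL (x ↾ n) (y ↾ n))
      xy∈T n = IsTree.closed T-tree (zipL-mono (↾-mono x n≤k) (limit-↾-⊑ n k (≤-trans (n≤1+n n) n<trunk)))
                 (subst (λ u → T (zipL u (trunk (state k)))) (node-state k) (node×trunk∈T (state k)))
        where
        k : ℕ
        k = proj₁ (long-enough n)
        n<trunk : n < length (trunk (state k))
        n<trunk = proj₂ (long-enough n)
        n≤k : n ≤ k
        n≤k = ≤-trans (n≤1+n n) (≤-trans n<trunk
                (subst (length (trunk (state k)) ≤_) (trans (cong length (node-state k)) (length-↾ x k))
                       (trunk-short (state k))))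

      x∈p[T] : p[T] x
      x∈p[T] = y , xy∈T

  dichotomy : (Σ (List ℕ → Set) λ H → IsH F H × (∀ x → Body H x → ¬ p[T] x))
            ⊎ (Σ (List ℕ → Set) λ L → IsL F L × (∀ x → Body L x → p[T] x))
  dichotomy with lem₁ {Doomed [] []}
  ... | yes doomed₀ = inj₁ (HSide.H doomed₀ , HSide.H-isH doomed₀ , HSide.H-disjoint-p[T] doomed₀)
  ... | no ¬doomed₀ = inj₂ (LSide.L ¬doomed₀ , LSide.L-isL ¬doomed₀ , LSide.x∈p[T] ¬doomed₀)

theorem8 : ExcludedMiddle 0ℓ → ExcludedMiddle (Level.suc 0ℓ) →
    (F : Subset → Set) → IsFilterExtCofinite F →
    (A : Baire → Set) → IsAnalytic A →
    (Σ (List ℕ → Set) λ H → IsH F H × (∀ x → Body H x → A x → ⊥))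
    ⊎ (Σ (List ℕ → Set) λ L → IsL F L × (∀ x → Body L x → A x))
theorem8 lem₀ lem₁ F F-filter A (T , T-tree , A⇔p[T]) =
  Sum.map (Product.map₂ (Product.map₂ λ H∩p[T]=∅ x x∈H → H∩p[T]=∅ x x∈H ∘ proj₁ (A⇔p[T] x)))
          (Product.map₂ (Product.map₂ λ L⊆p[T] x x∈L → proj₂ (A⇔p[T] x) (L⊆p[T] x x∈L)))
          (Game.dichotomy lem₀ lem₁ F-filter T T-tree)
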